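{- In the setting described in the context, let $M_0\in\mathcal C$ with $|M_0|\le10$. Then $n_m\big(\sum_{\alpha\in\Phi_G^+}\alpha-\sum_{\alpha\in M_0}\alpha\big)>0$ for all $m=1,\dots,8$. In particular, for any subset $M_1\subset\Phi_V-M_0$, the function $f:M_1\to\mathbb R_{\ge0}$ identically equal to $0$ satisfies $\sum_{\alpha\in M_1}f(\alpha)<|M_0|$ and $n_m\big(\sum_{\alpha\in\Phi_G^+}\alpha-\sum_{\alpha\in M_0}\alpha+\sum_{\alpha\in M_1}f(\alpha)\alpha\big)>0$ for all $m$.
   Context: Let $X=\mathbb Q^9/\mathbb Q(1,\dots,1)$ and let $\varepsilon_1,\dots,\varepsilon_9\in X$ be the images of the standard basis vectors (so $\sum_i\varepsilon_i=0$). For $1\le i<j<k\le9$ write $(ijk)=\varepsilon_i+\varepsilon_j+\varepsilon_k$, and let $\Phi_V$ be the set of these 84 elements. Let $\beta_m=\varepsilon_{m+1}-\varepsilon_m$ ($m=1,\dots,8$), a basis of $X$, and $\Phi_G^+=\{\varepsilon_j-\varepsilon_i:1\le i<j\le9\}$. For $\chi\in X$ let $n_m(\chi)$ be the coefficient of $\beta_m$ in $\chi$ with respect to the basis $\beta_1,\dots,\beta_8$. Define $\alpha\le\gamma$ iff $n_m(\gamma-\alpha)\in\mathbb Z_{\ge0}$ for all $m$. Let $\mathcal C$ be the set of non-empty subsets $M\subset\Phi_V$ such that $\alpha\in M$, $\gamma\in\Phi_V$, $\alpha\le\gamma$ imply $\gamma\in M$. -}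

module Defs where

open import Data.Nat as ℕ using (ℕ; suc)
open import Data.Integer using (ℤ; +_)
open import Data.Rational using (ℚ; 0ℚ; 1ℚ; _+_; _*_; _-_; -_; _/_)
open import Data.Fin using (Fin; toℕ; _≟_; _<?_)
open import Data.List using (List; []; _∷_; foldr; map; filter; allFin; concatMap)
open import Data.List.Membership.Propositional using (_∈_)
open import Data.Product using (_×_; _,_; ∃-syntax)
open import Data.Bool using (if_then_else_)
open import Relation.Nullary using (does)
open import Relation.Binary.PropositionalEquality using (_≡_)

-- Elements of X = ℚ^9 / ℚ(1,…,1) are represented by vectors in ℚ^9
-- (any representative); all notions below are invariant under adding
-- multiples of (1,…,1).  Indices 1..9 of the paper are Fin 9 = 0..8.
V : Set
V = Fin 9 → ℚ

zeroV : V
zeroV _ = 0ℚ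

_⊕_ : V → V → V
(u ⊕ v) k = u k + v k

_⊖_ : V → V → V
(u ⊖ v) k = u k - v k

_·_ : ℚ → V → V
(a · v) k = a * v k

ε : Fin 9 → V
ε i k = if does (i ≟ k) then 1ℚ else 0ℚ

Triple : Set
Triple = Fin 9 × Fin 9 × Fin 9

vec : Triple → V
vec (i , j , k) = (ε i ⊕ ε j) ⊕ ε k

PhiV : List Triple
PhiV = filter (λ { (i , j , k) → i <? j })
         (filter (λ { (i , j , k) → j <? k })
           (concatMap (λ i → concatMap (λ j → map (λ k → (i , j , k)) (allFin 9)) (allFin 9)) (allFin 9)))

PhiGplus : List V
PhiGplus = map (λ { (i , j) → ε j ⊖ ε i })
  (filter (λ { (i , j) → i <? j })
    (concatMap (λ i → map (λ j → (i , j)) (allFin 9)) (allFin 9)))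

sumV : List V → V
sumV = foldr _⊕_ zeroV

sumQ : List ℚ → ℚ
sumQ = foldr _+_ 0ℚ

partialSum : ℕ → V → ℚ
partialSum p c = sumQ (map c (filter (λ k → toℕ k ℕ.<? p) (allFin 9)))

-- n_m(χ): coefficient of β_m = ε_{m+1} - ε_m in χ w.r.t. the basis
-- β_1,…,β_8.  Here m : Fin 8 encodes the paper's index toℕ m + 1.
-- Solving χ ≡ Σ n_m β_m mod (1,…,1) gives
--   n_m(χ) = (m/9) Σ_k c_k - Σ_{k ≤ m} c_k   for a representative c.
ncoef : Fin 8 → V → ℚ
ncoef m c = ((+ suc (toℕ m)) / 9) * sumQ (map c (allFin 9)) - partialSum (suc (toℕ m)) c

_≼_ : Triple → Triple → Set
a ≼ g = ∀ (m : Fin 8) → ∃[ k ] (ncoef m (vec g ⊖ vec a) ≡ (+ k) / 1)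

sumT : List Triple → V
sumT M = sumV (map vec M)

{-# OPTIONS --safe #-}
-- For a representative c of χ, n_m(χ) = (m/9) Σ_k c_k − Σ_{k≤m} c_k is linear, so
-- n_m(2ρ) = m(9−m) while n_m((ijk)) = m/3 − #{i,j,k ≤ m} ≤ m/3.  Apart from (789)
-- at m = 6, every triple has n_m at most some c_m with 10 c_m < m(9−m); (789)
-- exceeds c_6 = 1 by 1, and can occur only once.  Hence any ten distinct triples
-- satisfy the bound.
module Submission where

open import Defs
open import Data.Nat as ℕ using (_≤_; z≤n; s≤s)
open import Data.Rational using (ℚ; 0ℚ; 1ℚ; _<_; _/_; _+_; _*_; _-_; -_; _≤?_; _<?_; +-0-rawMonoid)
  renaming (_≤_ to _≤ℚ_)
open import Data.Rational.Properties as ℚ using ()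
open import Data.Rational.Solver using (module +-*-Solver)
open import Data.Integer using (+_)
open import Data.Fin using (Fin; toℕ; #_)
open import Data.Fin.Properties using (_≟_; all?)
open import Data.List using (List; []; _∷_; length; map; allFin; filter)
open import Data.List.Membership.Propositional using (_∈_; _∉_)
open import Data.List.Relation.Unary.All as All using (All; []; _∷_)
open import Data.List.Relation.Unary.Any using (here; there)
open import Data.List.Relation.Unary.Unique.Propositional using (Unique)
open import Data.List.Relation.Unary.Unique.Propositional.Properties using (Unique[x∷xs]⇒x∉xs)
open import Data.List.Relation.Unary.AllPairs using (_∷_)
open import Data.Product using (_×_; _,_)
open import Data.Product.Properties using (≡-dec)
open import Data.Sum using (_⊎_; inj₁; inj₂)
open import Data.Vec using (lookup; []; _∷_)
open import Function using (_∘_)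
open import Data.Empty using (⊥-elim)
open import Algebra.Definitions.RawMonoid +-0-rawMonoid using () renaming (_×_ to _×ℚ_)
open import Relation.Nullary.Decidable using (Dec; toWitness; _⊎-dec_; _×-dec_)
open import Relation.Binary.Definitions using (DecidableEquality)
open import Relation.Binary.PropositionalEquality
open +-*-Solver using (solve; _:+_; _:*_; _:-_; _:=_)

×ℚ-monoˡ-≤ : ∀ {c} → 0ℚ ≤ℚ c → ∀ {n k} → n ≤ k → n ×ℚ c ≤ℚ k ×ℚ c
×ℚ-monoˡ-≤ 0≤c {k = ℕ.zero}  z≤n = ℚ.≤-refl
×ℚ-monoˡ-≤ 0≤c {k = ℕ.suc k} z≤n = ℚ.+-mono-≤ 0≤c (×ℚ-monoˡ-≤ 0≤c {k = k} z≤n)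
×ℚ-monoˡ-≤ {c} 0≤c (s≤s n≤k)         = ℚ.+-monoʳ-≤ c (×ℚ-monoˡ-≤ 0≤c n≤k)

module _ {A : Set} where

  sumQ-map-+ : (f g : A → ℚ) (xs : List A) →
               sumQ (map (λ x → f x + g x) xs) ≡ sumQ (map f xs) + sumQ (map g xs)
  sumQ-map-+ f g [] = refl
  sumQ-map-+ f g (x ∷ xs) rewrite sumQ-map-+ f g xs =
    solve 4 (λ a b c d → (a :+ b) :+ (c :+ d) := (a :+ c) :+ (b :+ d)) refl
      (f x) (g x) (sumQ (map f xs)) (sumQ (map g xs))

  sumQ-map-- : (f g : A → ℚ) (xs : List A) →
               sumQ (map (λ x → f x - g x) xs) ≡ sumQ (map f xs) - sumQ (map g xs)
  sumQ-map-- f g [] = refl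
  sumQ-map-- f g (x ∷ xs) rewrite sumQ-map-- f g xs =
    solve 4 (λ a b c d → (a :- b) :+ (c :- d) := (a :+ c) :- (b :+ d)) refl
      (f x) (g x) (sumQ (map f xs)) (sumQ (map g xs))

  sumQ-map-0 : (xs : List A) → sumQ (map (λ _ → 0ℚ) xs) ≡ 0ℚ
  sumQ-map-0 [] = refl
  sumQ-map-0 (x ∷ xs) rewrite sumQ-map-0 xs = refl

  sumQ-map-cong : {f g : A → ℚ} → (∀ x → f x ≡ g x) → (xs : List A) →
                  sumQ (map f xs) ≡ sumQ (map g xs)
  sumQ-map-cong f≗g [] = refl
  sumQ-map-cong f≗g (x ∷ xs) = cong₂ _+_ (f≗g x) (sumQ-map-cong f≗g xs)

  sumQ-map-≤-×ℚ : ∀ {f : A → ℚ} {c} (xs : List A) → All (λ x → f x ≤ℚ c) xs →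
                  sumQ (map f xs) ≤ℚ length xs ×ℚ c
  sumQ-map-≤-×ℚ []       []           = ℚ.≤-refl
  sumQ-map-≤-×ℚ (x ∷ xs) (fx≤c ∷ all) = ℚ.+-mono-≤ fx≤c (sumQ-map-≤-×ℚ xs all)

  sumQ-map-≤-×ℚ-except : ∀ {f : A → ℚ} {c d} (t : A) (xs : List A) → Unique xs →
                         (∀ {x} → x ∈ xs → x ≡ t ⊎ f x ≤ℚ c) → f t ≤ℚ c + d → 0ℚ ≤ℚ d →
                         sumQ (map f xs) ≤ℚ length xs ×ℚ c + d
  sumQ-map-≤-×ℚ-except t [] _ _ _ 0≤d = subst (0ℚ ≤ℚ_) (sym (ℚ.+-identityˡ _)) 0≤d
  sumQ-map-≤-×ℚ-except {f} {c} {d} t (x ∷ xs) uniq@(_ ∷ uniq′) bounded ft≤c+d 0≤d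
    with bounded (here refl)
  ... | inj₂ fx≤c = ℚ.≤-trans
          (ℚ.+-monoʳ-≤ (f x)
            (sumQ-map-≤-×ℚ-except t xs uniq′ (λ y∈xs → bounded (there y∈xs)) ft≤c+d 0≤d))
          (ℚ.≤-trans (ℚ.+-monoˡ-≤ _ fx≤c) (ℚ.≤-reflexive (sym (ℚ.+-assoc c _ d))))
  ... | inj₁ refl = ℚ.≤-trans
          (ℚ.+-mono-≤ ft≤c+d (sumQ-map-≤-×ℚ xs (All.tabulate rest-bounded)))
          (ℚ.≤-reflexive (solve 3 (λ c d s → (c :+ d) :+ s := (c :+ s) :+ d) refl c d _))
    where
    rest-bounded : ∀ {y} → y ∈ xs → f y ≤ℚ c
    rest-bounded y∈xs with bounded (there y∈xs)
    ... | inj₁ refl = ⊥-elim (Unique[x∷xs]⇒x∉xs uniq y∈xs)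
    ... | inj₂ fy≤c = fy≤c

weight : Fin 8 → ℚ
weight m = (+ ℕ.suc (toℕ m)) / 9

lower : Fin 8 → List (Fin 9)
lower m = filter (λ k → toℕ k ℕ.<? ℕ.suc (toℕ m)) (allFin 9)

ncoef-⊕ : ∀ m u v → ncoef m (u ⊕ v) ≡ ncoef m u + ncoef m v
ncoef-⊕ m u v =
  trans (cong₂ (λ s p → weight m * s - p) (sumQ-map-+ u v (allFin 9)) (sumQ-map-+ u v (lower m)))
        (solve 5 (λ w a b c d → w :* (a :+ b) :- (c :+ d) := (w :* a :- c) :+ (w :* b :- d))
               refl (weight m) _ _ _ _)

ncoef-⊖ : ∀ m u v → ncoef m (u ⊖ v) ≡ ncoef m u - ncoef m v
ncoef-⊖ m u v =
  trans (cong₂ (λ s p → weight m * s - p) (sumQ-map-- u v (allFin 9)) (sumQ-map-- u v (lower m)))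
        (solve 5 (λ w a b c d → w :* (a :- b) :- (c :- d) := (w :* a :- c) :- (w :* b :- d))
               refl (weight m) _ _ _ _)

ncoef-zeroV : ∀ m → ncoef m zeroV ≡ 0ℚ
ncoef-zeroV m =
  trans (cong₂ (λ s p → weight m * s - p) (sumQ-map-0 (allFin 9)) (sumQ-map-0 (lower m)))
        (trans (ℚ.+-identityʳ _) (ℚ.*-zeroʳ (weight m)))

ncoef-cong : ∀ m {u v : V} → (∀ k → u k ≡ v k) → ncoef m u ≡ ncoef m v
ncoef-cong m u≗v =
  cong₂ (λ s p → weight m * s - p) (sumQ-map-cong u≗v (allFin 9)) (sumQ-map-cong u≗v (lower m))

ncoef-sumT : ∀ m (M : List Triple) → ncoef m (sumT M) ≡ sumQ (map (ncoef m ∘ vec) M)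
ncoef-sumT m []      = ncoef-zeroV m
ncoef-sumT m (a ∷ M) =
  trans (ncoef-⊕ m (vec a) (sumT M)) (cong (λ s → ncoef m (vec a) + s) (ncoef-sumT m M))

sumV-zero-combination : (M : List Triple) (k : Fin 9) → sumV (map (λ a → 0ℚ · vec a) M) k ≡ 0ℚ
sumV-zero-combination []      k = refl
sumV-zero-combination (a ∷ M) k rewrite sumV-zero-combination M k =
  trans (ℚ.+-identityʳ _) (ℚ.*-zeroˡ (vec a k))

t789 : Triple
t789 = # 6 , # 7 , # 8

_≟T_ : DecidableEquality Triple
_≟T_ = ≡-dec _≟_ (≡-dec _≟_ _≟_)

-- bound m is the maximum of n_m over Φ_V − {(789)}; n_m(789) exceeds it only for the
-- paper's m = 6 (index 5 here), by 1.
bound excess : Fin 8 → ℚ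
bound  = lookup ((+ 1) / 3 ∷ (+ 2) / 3 ∷ 1ℚ ∷ (+ 4) / 3 ∷ (+ 5) / 3 ∷ 1ℚ ∷ (+ 4) / 3 ∷ (+ 2) / 3 ∷ [])
excess = lookup (0ℚ ∷ 0ℚ ∷ 0ℚ ∷ 0ℚ ∷ 0ℚ ∷ 1ℚ ∷ 0ℚ ∷ 0ℚ ∷ [])

Certified : Fin 8 → Set
Certified m = All (λ a → a ≡ t789 ⊎ ncoef m (vec a) ≤ℚ bound m) PhiV
            × ncoef m (vec t789) ≤ℚ bound m + excess m
            × 0ℚ ≤ℚ bound m × 0ℚ ≤ℚ excess m
            × 10 ×ℚ bound m + excess m < ncoef m (sumV PhiGplus)

certified? : ∀ m → Dec (Certified m)
certified? m = All.all? (λ a → (a ≟T t789) ⊎-dec (ncoef m (vec a) ≤? bound m)) PhiV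
         ×-dec (_ ≤? _) ×-dec (0ℚ ≤? _) ×-dec (0ℚ ≤? _) ×-dec (_ <? _)

certified : ∀ m → Certified m
certified = toWitness {a? = all? certified?} _

ncoef-sumT-< : ∀ m → Certified m → (M : List Triple) → Unique M → (∀ {a} → a ∈ M → a ∈ PhiV) →
               length M ≤ 10 → ncoef m (sumT M) < ncoef m (sumV PhiGplus)
ncoef-sumT-< m (all-bounded , t789-bounded , 0≤bound , 0≤excess , margin) M uniq M⊆PhiV len≤10 =
  begin-strict
  ncoef m (sumT M)                  ≡⟨ ncoef-sumT m M ⟩
  sumQ (map (ncoef m ∘ vec) M)      ≤⟨ sumQ-map-≤-×ℚ-except t789 M uniq
                                         (All.lookup all-bounded ∘ M⊆PhiV) t789-bounded 0≤excess ⟩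
  length M ×ℚ bound m + excess m    ≤⟨ ℚ.+-monoˡ-≤ (excess m) (×ℚ-monoˡ-≤ 0≤bound len≤10) ⟩
  10 ×ℚ bound m + excess m          <⟨ margin ⟩
  ncoef m (sumV PhiGplus)           ∎
  where open ℚ.≤-Reasoning

p<q⇒0<q-p : ∀ {p q} → p < q → 0ℚ < q - p
p<q⇒0<q-p {p} {q} p<q = subst (_< q - p) (ℚ.+-inverseʳ p) (ℚ.+-monoˡ-< (- p) p<q)

ncoef-2ρ-minus-positive : (M : List Triple) → Unique M → (∀ {a} → a ∈ M → a ∈ PhiV) → length M ≤ 10 →
                          ∀ m → 0ℚ < ncoef m (sumV PhiGplus ⊖ sumT M)
ncoef-2ρ-minus-positive M uniq M⊆PhiV len≤10 m =
  subst (0ℚ <_) (sym (ncoef-⊖ m (sumV PhiGplus) (sumT M)))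
        (p<q⇒0<q-p (ncoef-sumT-< m (certified m) M uniq M⊆PhiV len≤10))

lemma6p7 : (M₀ : List Triple) → Unique M₀ → (∀ {a} → a ∈ M₀ → a ∈ PhiV) → M₀ ≢ []
    → (∀ {a g} → a ∈ M₀ → g ∈ PhiV → a ≼ g → g ∈ M₀)
    → length M₀ ≤ 10
    → (∀ (m : Fin 8) → 0ℚ < ncoef m (sumV PhiGplus ⊖ sumT M₀))
      × (∀ (M₁ : List Triple) → Unique M₁ → (∀ {a} → a ∈ M₁ → a ∈ PhiV × a ∉ M₀)
          → (sumQ (map (λ _ → 0ℚ) M₁) < (+ length M₀) / 1)
            × (∀ (m : Fin 8) → 0ℚ < ncoef m ((sumV PhiGplus ⊖ sumT M₀) ⊕ sumV (map (λ a → 0ℚ · vec a) M₁))))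
lemma6p7 [] _ _ M₀≢[] _ _ = ⊥-elim (M₀≢[] refl)
lemma6p7 M₀@(_ ∷ _) uniq M₀⊆PhiV _ _ len≤10 = positive , λ M₁ _ _ →
    subst (_< (+ length M₀) / 1) (sym (sumQ-map-0 M₁))
          (ℚ.positive⁻¹ _ {{ℚ.normalize-pos (length M₀) 1}})
  , λ m → subst (0ℚ <_) (ncoef-cong m (λ k → sym (drop-zero-combination M₁ k))) (positive m)
  where
  χ : V
  χ = sumV PhiGplus ⊖ sumT M₀

  positive : ∀ m → 0ℚ < ncoef m χ
  positive = ncoef-2ρ-minus-positive M₀ uniq M₀⊆PhiV len≤10

  drop-zero-combination : (M₁ : List Triple) (k : Fin 9) →
                          (χ ⊕ sumV (map (λ a → 0ℚ · vec a) M₁)) k ≡ χ k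
  drop-zero-combination M₁ k =
    trans (cong (λ s → χ k + s) (sumV-zero-combination M₁ k)) (ℚ.+-identityʳ (χ k))
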